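{- For any pair of positive integers $r_1,r_2$, there exists a finite strongly connected digraph $G$ such that $r^+(G)=r_1$ and $r^-(G)=r_2$.
   Context: A digraph $G=(V,E)$ has a finite vertex set and a finite multiset of arcs (loops and multiple arcs allowed). $\mathrm{dist}_G(u,v)$ is the length of a shortest directed path from $u$ to $v$; $G$ is strongly connected if all these are finite. The out-eccentricity is $\mathrm{ecc}^+(u)=\max_{v}\mathrm{dist}_G(u,v)$ and the in-eccentricity is $\mathrm{ecc}^-(u)=\max_v \mathrm{dist}_G(v,u)$. The inner out-radius is $r^+(G)=\min_{u\in V}\mathrm{ecc}^+(u)$ and the inner in-radius is $r^-(G)=\min_{u\in V}\mathrm{ecc}^-(u)$. -}

module Defs where

open import Data.Nat using (ℕ; zero; suc; _≤_)
open import Data.Fin using (Fin)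
open import Data.List using (List)
open import Data.Product using (_×_; _,_; ∃; ∃-syntax)
open import Data.List.Membership.Propositional using (_∈_)

-- A finite digraph: vertex set Fin n, arcs a finite multiset (list) of
-- ordered pairs (tail , head); loops and repeated arcs are allowed.
record Digraph : Set where
  field
    n    : ℕ
    arcs : List (Fin n × Fin n)
open Digraph public

data Walk (G : Digraph) : Fin (n G) → Fin (n G) → ℕ → Set where
  nil  : ∀ {u} → Walk G u u 0
  cons : ∀ {u w v k} → (u , w) ∈ arcs G → Walk G w v k → Walk G u v (suc k)

Dist : (G : Digraph) → Fin (n G) → Fin (n G) → ℕ → Set
Dist G u v d = Walk G u v d × (∀ m → Walk G u v m → d ≤ m)

StronglyConnected : Digraph → Set
StronglyConnected G = ∀ u v → ∃[ d ] Dist G u v d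

OutEcc : (G : Digraph) → Fin (n G) → ℕ → Set
OutEcc G u e = (∃[ v ] Dist G u v e) × (∀ v d → Dist G u v d → d ≤ e)

InEcc : (G : Digraph) → Fin (n G) → ℕ → Set
InEcc G u e = (∃[ v ] Dist G v u e) × (∀ v d → Dist G v u d → d ≤ e)

OutRadius : Digraph → ℕ → Set
OutRadius G r = (∃[ u ] OutEcc G u r) × (∀ u e → OutEcc G u e → r ≤ e)

InRadius : Digraph → ℕ → Set
InRadius G r = (∃[ u ] InEcc G u r) × (∀ u e → InEcc G u e → r ≤ e)

-- For a ≤ b take the vertices 0, …, a+2b−1 with the arcs x → x+1, an arc from a−1 to every
-- vertex ≥ a, and arcs back to 0 from the ends a+b−1 and a+2b−1 of the two arms [a, a+b) and
-- [a+b, a+2b).  Vertex 0 reaches every vertex within a steps and is reached from every vertex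
-- within b steps.  For the lower bounds, a potential φ with φ x ≤ 1 + φ y along every arc
-- forces dist(u, v) ≥ φ u − φ v.  Collapsing all vertices ≥ a to a single one (x ↦ x ⊓ a) maps
-- the digraph onto a directed cycle of length a+1, so the distance along that cycle shows that
-- every vertex has a vertex at distance ≥ a from it; the distance to the end of an arm shows
-- that every vertex is at distance ≥ b from the start of one of the arms.  The case a > b
-- follows by reversing all arcs of the digraph for (b, a).

module Submission where

open import Defs
open import Data.Nat using (ℕ; _≤_)
open import Data.Product using (_×_; ∃-syntax)
open import Data.Nat using (zero; suc; _+_; _∸_; _⊓_; _<_; z≤n; s≤s; s≤s⁻¹; z<s; _≟_; _≤?_; _<?_)
open import Data.Nat.Properties
open import Data.Fin using (Fin; toℕ; fromℕ<) renaming (zero to 0F)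
open import Data.Fin.Properties using (toℕ-injective; toℕ-fromℕ<; toℕ<n; any?)
  renaming (_≟_ to _≟ᶠ_)
open import Data.List using (map; filter; cartesianProduct; allFin)
open import Data.List.Membership.Propositional using (_∈_)
open import Data.List.Membership.Propositional.Properties
  using (∈-map⁺; ∈-map⁻; ∈-filter⁺; ∈-filter⁻; ∈-cartesianProduct⁺; ∈-allFin)
open import Data.Product using (_,_; proj₁; proj₂; map₂; swap)
open import Data.Product.Properties using (≡-dec)
open import Data.Sum using (_⊎_; inj₁; inj₂)
open import Function using (_∘_)
open import Relation.Binary.Definitions using (Decidable)
open import Relation.Nullary using (Dec; yes; no; contradiction)
open import Relation.Nullary.Decidable using (map′; _×-dec_; _⊎-dec_)
open import Relation.Binary.PropositionalEquality using (_≡_; refl; sym; trans; cong; subst)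

∃-least : {P : ℕ → Set} → (∀ m → Dec (P m)) → ∀ {k} → P k → ∃[ m ] (P m × ∀ j → P j → m ≤ j)
∃-least P? p with P? 0
... | yes p₀ = 0 , p₀ , λ _ _ → z≤n
∃-least P? {zero} p | no ¬p₀ = contradiction p ¬p₀
∃-least P? {suc k} p | no ¬p₀ with ∃-least (P? ∘ suc) p
... | m , pₘ , minimal = suc m , pₘ , λ
  { zero p₀ → contradiction p₀ ¬p₀
  ; (suc j) pⱼ → s≤s (minimal j pⱼ) }

module _ {G : Digraph} where

  infixr 5 _++ʷ_
  infixl 5 _▷_

  _++ʷ_ : ∀ {u w v k m} → Walk G u w k → Walk G w v m → Walk G u v (k + m)
  nil ++ʷ w′ = w′
  cons e w ++ʷ w′ = cons e (w ++ʷ w′)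

  _▷_ : ∀ {u w v k} → Walk G u w k → (w , v) ∈ arcs G → Walk G u v (suc k)
  nil ▷ e = cons e nil
  cons e′ w ▷ e = cons e′ (w ▷ e)

  walk? : ∀ k u v → Dec (Walk G u v k)
  walk? zero u v = map′ (λ { refl → nil }) (λ { nil → refl }) (u ≟ᶠ v)
  walk? (suc k) u v =
    map′ (λ (w , e , w′) → cons e w′) (λ { (cons e w′) → _ , e , w′ })
         (any? λ w → ((u , w) ∈? arcs G) ×-dec walk? k w v)
    where open import Data.List.Membership.DecPropositional (≡-dec _≟ᶠ_ _≟ᶠ_) using (_∈?_)

  walk⇒dist : ∀ {u v k} → Walk G u v k → ∃[ d ] Dist G u v d
  walk⇒dist {u} {v} = ∃-least (λ m → walk? m u v)

  Potential : (Fin (n G) → ℕ) → Set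
  Potential φ = ∀ {u v} → (u , v) ∈ arcs G → φ u ≤ suc (φ v)

  walk-potential : ∀ {φ} → Potential φ → ∀ {u v k} → Walk G u v k → φ u ≤ k + φ v
  walk-potential φ-pot nil = ≤-refl
  walk-potential φ-pot (cons e w) = ≤-trans (φ-pot e) (s≤s (walk-potential φ-pot w))

  potential≤walk-length : ∀ {φ} → Potential φ → ∀ {u t k} → φ t ≡ 0 → Walk G u t k → φ u ≤ k
  potential≤walk-length {φ} φ-pot {u} {t} {k} φt≡0 w =
    subst (φ u ≤_) (trans (cong (k +_) φt≡0) (+-identityʳ k)) (walk-potential φ-pot w)

-- OutRadius G r and InRadius G r unfold to Radius (Walk G) r and Radius (λ u v → Walk G v u) r.
module _ {V : Set} (W : V → V → ℕ → Set) where

  Shortest : V → V → ℕ → Set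
  Shortest u v d = W u v d × (∀ m → W u v m → d ≤ m)

  Ecc : V → ℕ → Set
  Ecc u e = (∃[ v ] Shortest u v e) × (∀ v d → Shortest u v d → d ≤ e)

  Radius : ℕ → Set
  Radius r = (∃[ u ] Ecc u r) × (∀ u e → Ecc u e → r ≤ e)

  radius-via-hub : ∀ {r} → (∀ u v → ∃[ d ] Shortest u v d) → (c : V) →
                   (∀ v → ∃[ k ] (k ≤ r × W c v k)) →
                   (∀ u → ∃[ t ] (∀ {k} → W u t k → r ≤ k)) →
                   Radius r
  radius-via-hub {r} shortest c near far = (c , (t , exact) , ecc-c≤r) , r≤ecc
    where
    ecc-c≤r : ∀ v d → Shortest c v d → d ≤ r
    ecc-c≤r v d (_ , minimal) = let k , k≤r , w = near v in ≤-trans (minimal k w) k≤r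

    r≤ecc : ∀ u e → Ecc u e → r ≤ e
    r≤ecc u e (_ , ecc≤e) =
      let t , far-t = far u
          d , sp    = shortest u t
      in ≤-trans (far-t (proj₁ sp)) (ecc≤e t d sp)

    t : V
    t = proj₁ (far c)

    exact : Shortest c t r
    exact = let d , sp = shortest c t
            in subst (Shortest c t) (≤-antisym (ecc-c≤r t d sp) (proj₂ (far c) (proj₁ sp))) sp

record HubCertificate (G : Digraph) (r⁺ r⁻ : ℕ) : Set where
  field
    hub      : Fin (n G)
    out-walk : ∀ v → ∃[ k ] (k ≤ r⁺ × Walk G hub v k)
    in-walk  : ∀ v → ∃[ k ] (k ≤ r⁻ × Walk G v hub k)
    out-far  : ∀ u → ∃[ t ] (∀ {k} → Walk G u t k → r⁺ ≤ k)
    in-far   : ∀ u → ∃[ s ] (∀ {k} → Walk G s u k → r⁻ ≤ k)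

module _ {G : Digraph} {r⁺ r⁻ : ℕ} (cert : HubCertificate G r⁺ r⁻) where
  open HubCertificate cert

  hub⇒stronglyConnected : StronglyConnected G
  hub⇒stronglyConnected u v = walk⇒dist (proj₂ (proj₂ (in-walk u)) ++ʷ proj₂ (proj₂ (out-walk v)))

  hub⇒outRadius : OutRadius G r⁺
  hub⇒outRadius = radius-via-hub (Walk G) hub⇒stronglyConnected hub out-walk out-far

  hub⇒inRadius : InRadius G r⁻
  hub⇒inRadius =
    radius-via-hub (λ u v → Walk G v u) (λ u v → hub⇒stronglyConnected v u) hub in-walk in-far

  hub⇒radii : StronglyConnected G × OutRadius G r⁺ × InRadius G r⁻
  hub⇒radii = hub⇒stronglyConnected , hub⇒outRadius , hub⇒inRadius

transpose : Digraph → Digraph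
transpose G = record { n = n G ; arcs = map swap (arcs G) }

module _ {G : Digraph} where

  ∈-transpose⁺ : ∀ {u v} → (u , v) ∈ arcs G → (v , u) ∈ arcs (transpose G)
  ∈-transpose⁺ = ∈-map⁺ swap

  ∈-transpose⁻ : ∀ {u v} → (u , v) ∈ arcs (transpose G) → (v , u) ∈ arcs G
  ∈-transpose⁻ e with ∈-map⁻ swap e
  ... | _ , e′ , refl = e′

  reverse : ∀ {u v k} → Walk G u v k → Walk (transpose G) v u k
  reverse nil = nil
  reverse (cons e w) = reverse w ▷ ∈-transpose⁺ e

  reverse⁻ : ∀ {u v k} → Walk (transpose G) u v k → Walk G v u k
  reverse⁻ nil = nil
  reverse⁻ (cons e w) = reverse⁻ w ▷ ∈-transpose⁻ e

  transpose-certificate : ∀ {r⁺ r⁻} → HubCertificate G r⁺ r⁻ → HubCertificate (transpose G) r⁻ r⁺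
  transpose-certificate cert = record
    { hub      = hub
    ; out-walk = map₂ (map₂ reverse) ∘ in-walk
    ; in-walk  = map₂ (map₂ reverse) ∘ out-walk
    ; out-far  = map₂ (λ far {k} w → far (reverse⁻ w)) ∘ in-far
    ; in-far   = map₂ (λ far {k} w → far (reverse⁻ w)) ∘ out-far
    }
    where open HubCertificate cert

data Path (R : ℕ → ℕ → Set) : ℕ → ℕ → ℕ → Set where
  nil  : ∀ {x} → Path R x x 0
  cons : ∀ {x y z k} → R x y → Path R y z k → Path R x z (suc k)

infixl 5 _▷ᵖ_

_▷ᵖ_ : ∀ {R x y z k} → Path R x y k → R y z → Path R x z (suc k)
nil ▷ᵖ r = cons r nil
cons r′ w ▷ᵖ r = cons r′ (w ▷ᵖ r)

decide-on-Fin : ∀ {N} {R : ℕ → ℕ → Set} → Decidable R →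
                (uv : Fin N × Fin N) → Dec (R (toℕ (proj₁ uv)) (toℕ (proj₂ uv)))
decide-on-Fin R? (u , v) = R? (toℕ u) (toℕ v)

fromRel : (N : ℕ) (R : ℕ → ℕ → Set) → Decidable R → Digraph
fromRel N R R? = record
  { n    = N
  ; arcs = filter (decide-on-Fin R?) (cartesianProduct (allFin N) (allFin N))
  }

module _ {N : ℕ} {R : ℕ → ℕ → Set} {R? : Decidable R} where

  ∈-fromRel⁺ : ∀ {u v} → R (toℕ u) (toℕ v) → (u , v) ∈ arcs (fromRel N R R?)
  ∈-fromRel⁺ = ∈-filter⁺ (decide-on-Fin R?) (∈-cartesianProduct⁺ (∈-allFin _) (∈-allFin _))

  ∈-fromRel⁻ : ∀ {u v} → (u , v) ∈ arcs (fromRel N R R?) → R (toℕ u) (toℕ v)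
  ∈-fromRel⁻ = proj₂ ∘ ∈-filter⁻ (decide-on-Fin R?) {xs = cartesianProduct (allFin N) (allFin N)}

  fromRel-potential : (f : ℕ → ℕ) → (∀ {x y} → R x y → f x ≤ suc (f y)) →
                      Potential {fromRel N R R?} (f ∘ toℕ)
  fromRel-potential f f-pot = f-pot ∘ ∈-fromRel⁻

  path⇒walk : (∀ {x y} → R x y → y < N) → ∀ {x y k} → Path R x y k →
              ∀ {u v} → toℕ u ≡ x → toℕ v ≡ y → Walk (fromRel N R R?) u v k
  path⇒walk bounded nil refl v≡u = subst (λ v → Walk _ _ v 0) (toℕ-injective (sym v≡u)) nil
  path⇒walk bounded (cons r w) refl v≡z =
    cons (∈-fromRel⁺ (subst (R _) (sym (toℕ-fromℕ< (bounded r))) r))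
         (path⇒walk bounded w (toℕ-fromℕ< (bounded r)) v≡z)

m∸n≤1+m∸[1+n] : ∀ m n → m ∸ n ≤ suc (m ∸ suc n)
m∸n≤1+m∸[1+n] zero    zero    = z≤n
m∸n≤1+m∸[1+n] zero    (suc n) = z≤n
m∸n≤1+m∸[1+n] (suc m) zero    = ≤-refl
m∸n≤1+m∸[1+n] (suc m) (suc n) = m∸n≤1+m∸[1+n] m n

-- cycleDist s c is the length of the path from s to c along the cycle 0 → 1 → ⋯ → ℓ → 0.
module Cycle (ℓ : ℕ) where

  cycleDist : ℕ → ℕ → ℕ
  cycleDist s c with s ≤? c
  ... | yes _ = c ∸ s
  ... | no  _ = ℓ + suc c ∸ s

  cyclePred : ℕ → ℕ
  cyclePred zero    = ℓ
  cyclePred (suc s) = s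

  cyclePred-≤ : ∀ {s} → s ≤ ℓ → cyclePred s ≤ ℓ
  cyclePred-≤ {zero}  _   = ≤-refl
  cyclePred-≤ {suc s} s<ℓ = <⇒≤ s<ℓ

  cycleDist-self : ∀ c → cycleDist c c ≡ 0
  cycleDist-self c with c ≤? c
  ... | yes _   = n∸n≡0 c
  ... | no  c≰c = contradiction ≤-refl c≰c

  cycleDist-cyclePred : ∀ s → cycleDist s (cyclePred s) ≡ ℓ
  cycleDist-cyclePred zero = refl
  cycleDist-cyclePred (suc s) with suc s ≤? s
  ... | yes s<s = contradiction s<s (n≮n s)
  ... | no  _   = m+n∸n≡m ℓ (suc s)

  cycleDist-advance : ∀ s c → cycleDist s c ≤ suc (cycleDist (suc s) c)
  cycleDist-advance s c with s ≤? c | suc s ≤? c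
  ... | yes _   | yes _   = m∸n≤1+m∸[1+n] c s
  ... | yes s≤c | no  s≮c = ≤-trans (≤-reflexive (m≤n⇒m∸n≡0 (≮⇒≥ s≮c))) z≤n
  ... | no  s≰c | yes s<c = contradiction (<⇒≤ s<c) s≰c
  ... | no  _   | no  _   = m∸n≤1+m∸[1+n] (ℓ + suc c) s

  cycleDist-wrap : ∀ c → cycleDist ℓ c ≤ suc (cycleDist 0 c)
  cycleDist-wrap c with ℓ ≤? c
  ... | yes _ = ≤-trans (m∸n≤m c ℓ) (n≤1+n c)
  ... | no  _ = ≤-reflexive (m+n∸m≡n ℓ (suc c))

module TwoArmDigraph (p q : ℕ) where

  a b A N : ℕ
  a = suc p
  b = suc q
  A = a + b
  N = A + b

  ArmEnd : ℕ → Set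
  ArmEnd x = x ≡ a + q ⊎ x ≡ A + q

  Arc : ℕ → ℕ → Set
  Arc x y = (y ≡ suc x × suc x < N) ⊎ (x ≡ p × a ≤ y × y < N) ⊎ (ArmEnd x × y ≡ 0)

  pattern step x<N        = inj₁ (refl , x<N)
  pattern fan a≤y y<N     = inj₂ (inj₁ (refl , a≤y , y<N))
  pattern return-to-0 end = inj₂ (inj₂ (end , refl))

  arc? : Decidable Arc
  arc? x y = (y ≟ suc x ×-dec suc x <? N)
       ⊎-dec (x ≟ p ×-dec a ≤? y ×-dec y <? N)
       ⊎-dec ((x ≟ a + q ⊎-dec x ≟ A + q) ×-dec y ≟ 0)

  G : Digraph
  G = fromRel N Arc arc?

  a≤A : a ≤ A
  a≤A = m≤m+n a b

  A<N : A < N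
  A<N = m<m+n A z<s

  a<N : a < N
  a<N = ≤-<-trans a≤A A<N

  p<N : p < N
  p<N = <-trans (n<1+n p) a<N

  a+q<A : a + q < A
  a+q<A = +-monoʳ-< a (n<1+n q)

  armEnd<N : ∀ {x} → ArmEnd x → x < N
  armEnd<N (inj₁ refl) = <-trans a+q<A A<N
  armEnd<N (inj₂ refl) = +-monoʳ-< A (n<1+n q)

  a≤armEnd : ∀ {x} → ArmEnd x → a ≤ x
  a≤armEnd (inj₁ refl) = m≤m+n a q
  a≤armEnd (inj₂ refl) = ≤-trans a≤A (m≤m+n A q)

  arc-target<N : ∀ {x y} → Arc x y → y < N
  arc-target<N (step x<N)      = x<N
  arc-target<N (fan _ y<N)     = y<N
  arc-target<N (return-to-0 _) = z<s

  lift : ∀ {u v k} → Path Arc (toℕ u) (toℕ v) k → Walk G u v k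
  lift w = path⇒walk {R? = arc?} arc-target<N w refl refl

  climb : ∀ m {x} → m + x < N → Path Arc x (m + x) m
  climb zero    _  = nil
  climb (suc m) lt = climb m (<-trans (n<1+n _) lt) ▷ᵖ step lt

  climb-to : ∀ {x y} → x ≤ y → y < N → Path Arc x y (y ∸ x)
  climb-to {x} {y} x≤y y<N =
    subst (λ z → Path Arc x z (y ∸ x)) (m∸n+n≡m x≤y)
          (climb (y ∸ x) (subst (_< N) (sym (m∸n+n≡m x≤y)) y<N))

  path-from-0 : ∀ {y} → y < N → ∃[ k ] (k ≤ a × Path Arc 0 y k)
  path-from-0 {y} y<N with y <? a
  ... | yes y<a = y , <⇒≤ y<a , climb-to z≤n y<N
  ... | no  y≮a = a , ≤-refl , climb-to z≤n p<N ▷ᵖ fan (≮⇒≥ y≮a) y<N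

  module _ (p≤q : p ≤ q) where

    core-path-to-0 : ∀ {x} → x < a → ∃[ k ] (k ≤ b × Path Arc x 0 k)
    core-path-to-0 {zero}  _   = 0 , z≤n , nil
    core-path-to-0 {suc x} x<a =
      _ , s≤s (≤-trans (∸-monoʳ-< z<s (s≤s⁻¹ x<a)) p≤q) ,
      climb-to (s≤s⁻¹ x<a) p<N ▷ᵖ fan (m≤m+n a q) (armEnd<N (inj₁ refl)) ▷ᵖ return-to-0 (inj₁ refl)

    arm-path-to-0 : ∀ {lo x} → ArmEnd (lo + q) → lo ≤ x → x < lo + b →
                    ∃[ k ] (k ≤ b × Path Arc x 0 k)
    arm-path-to-0 {lo} {x} end lo≤x x<lo+b =
      _ , s≤s (≤-trans (∸-monoʳ-≤ (lo + q) lo≤x) (≤-reflexive (m+n∸m≡n lo q))) ,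
      climb-to (s≤s⁻¹ (subst (x <_) (+-suc lo q) x<lo+b)) (armEnd<N end) ▷ᵖ return-to-0 end

    path-to-0 : ∀ {x} → x < N → ∃[ k ] (k ≤ b × Path Arc x 0 k)
    path-to-0 {x} x<N with x <? a | x <? A
    ... | yes x<a | _       = core-path-to-0 x<a
    ... | no  x≮a | yes x<A = arm-path-to-0 (inj₁ refl) (≮⇒≥ x≮a) x<A
    ... | no  _   | no  x≮A = arm-path-to-0 (inj₂ refl) (≮⇒≥ x≮A) x<N

  open Cycle a

  position : ℕ → ℕ
  position x = x ⊓ a

  cycle-potential : ∀ c {x y} → Arc x y → cycleDist (position x) c ≤ suc (cycleDist (position y) c)
  cycle-potential c {x} (step _) with x ≤? p
  ... | yes x≤p rewrite m≤n⇒m⊓n≡m (m≤n⇒m≤1+n x≤p) | m≤n⇒m⊓n≡m x≤p = cycleDist-advance x c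
  ... | no  x≰p rewrite m≥n⇒m⊓n≡n (≰⇒> x≰p) | m≥n⇒m⊓n≡n (<⇒≤ (≰⇒> x≰p)) = n≤1+n _
  cycle-potential c (fan a≤y _)
    rewrite m≤n⇒m⊓n≡m (n≤1+n p) | m≥n⇒m⊓n≡n a≤y = cycleDist-advance p c
  cycle-potential c (return-to-0 end)
    rewrite m≥n⇒m⊓n≡n (a≤armEnd end) = cycleDist-wrap c

  cycle-source : ∀ {c} → (c≤a : c ≤ a) → ∀ {u k} → Walk G u (fromℕ< (≤-<-trans c≤a a<N)) k →
                 cycleDist (position (toℕ u)) c ≤ k
  cycle-source {c} c≤a = potential≤walk-length φ-potential φ≡0
    where
    φ-potential : Potential {G} (λ v → cycleDist (position (toℕ v)) c)
    φ-potential = fromRel-potential {R? = arc?} (λ x → cycleDist (position x) c) (cycle-potential c)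
    φ≡0 : cycleDist (position (toℕ (fromℕ< (≤-<-trans c≤a a<N)))) c ≡ 0
    φ≡0 rewrite toℕ-fromℕ< (≤-<-trans c≤a a<N) | m≤n⇒m⊓n≡m c≤a = cycleDist-self c

  out-far : ∀ u → ∃[ t ] (∀ {k} → Walk G u t k → a ≤ k)
  out-far u = _ , λ w → subst (_≤ _) (cycleDist-cyclePred (position (toℕ u)))
                                (cycle-source (cyclePred-≤ (m⊓n≤n (toℕ u) a)) w)

  armPotential : ℕ → ℕ → ℕ
  armPotential lo y with lo ≤? y
  ... | yes _ = lo + b ∸ y
  ... | no  _ = 0

  armPotential-start : ∀ lo → armPotential lo lo ≡ b
  armPotential-start lo with lo ≤? lo
  ... | yes _     = m+n∸m≡n lo b
  ... | no  lo≰lo = contradiction ≤-refl lo≰lo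

  armPotential-outside : ∀ {lo y} → y < lo ⊎ lo + b ≤ y → armPotential lo y ≡ 0
  armPotential-outside {lo} {y} outside with lo ≤? y | outside
  ... | yes lo≤y | inj₁ y<lo = contradiction lo≤y (<⇒≱ y<lo)
  ... | yes _    | inj₂ end≤y = m≤n⇒m∸n≡0 end≤y
  ... | no  _    | _ = refl

  arm-potential : ∀ {lo} → a ≤ lo → (∀ {x} → lo ≤ x → ArmEnd x → lo + b ≤ suc x) →
                  ∀ {x y} → Arc x y → armPotential lo x ≤ suc (armPotential lo y)
  arm-potential {lo} a≤lo exits {x} arc with lo ≤? x
  ... | no  _    = z≤n
  ... | yes lo≤x with arc
  ...   | fan _ _ = contradiction (≤-trans a≤lo lo≤x) (n≮n p)
  ...   | return-to-0 end =
    ≤-trans (∸-monoˡ-≤ x (exits lo≤x end)) (≤-trans (≤-reflexive (m+n∸n≡m 1 x)) (s≤s z≤n))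
  ...   | step _ with lo ≤? suc x
  ...     | yes _      = m∸n≤1+m∸[1+n] (lo + b) x
  ...     | no  lo≰1+x = contradiction (m≤n⇒m≤1+n lo≤x) lo≰1+x

  arm-source : ∀ {lo} → a ≤ lo → (∀ {x} → lo ≤ x → ArmEnd x → lo + b ≤ suc x) → (lo<N : lo < N) →
               ∀ {u} → toℕ u < lo ⊎ lo + b ≤ toℕ u → ∀ {k} → Walk G (fromℕ< lo<N) u k → b ≤ k
  arm-source {lo} a≤lo exits lo<N outside w =
    subst (_≤ _) (trans (cong (armPotential lo) (toℕ-fromℕ< lo<N)) (armPotential-start lo))
          (potential≤walk-length φ-potential (armPotential-outside outside) w)
    where
    φ-potential : Potential {G} (armPotential lo ∘ toℕ)
    φ-potential = fromRel-potential {R? = arc?} (armPotential lo) (arm-potential a≤lo exits)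

  first-arm-exits : ∀ {x} → a ≤ x → ArmEnd x → A ≤ suc x
  first-arm-exits _ (inj₁ refl) = ≤-reflexive (+-suc a q)
  first-arm-exits _ (inj₂ refl) = ≤-trans (m≤m+n A q) (n≤1+n _)

  second-arm-exits : ∀ {x} → A ≤ x → ArmEnd x → N ≤ suc x
  second-arm-exits A≤x (inj₁ refl) = contradiction a+q<A (≤⇒≯ A≤x)
  second-arm-exits _   (inj₂ refl) = ≤-reflexive (+-suc A q)

  in-far : ∀ u → ∃[ s ] (∀ {k} → Walk G s u k → b ≤ k)
  in-far u with toℕ u <? a | toℕ u <? A
  ... | yes u<a | _       = _ , arm-source ≤-refl first-arm-exits a<N (inj₁ u<a)
  ... | no  _   | yes u<A = _ , arm-source a≤A second-arm-exits A<N (inj₁ u<A)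
  ... | no  _   | no  u≮A = _ , arm-source ≤-refl first-arm-exits a<N (inj₂ (≮⇒≥ u≮A))

  certificate : p ≤ q → HubCertificate G a b
  certificate p≤q = record
    { hub      = 0F
    ; out-walk = λ v → map₂ (map₂ lift) (path-from-0 (toℕ<n v))
    ; in-walk  = λ v → map₂ (map₂ lift) (path-to-0 p≤q (toℕ<n v))
    ; out-far  = out-far
    ; in-far   = in-far
    }

proposition4 : ∀ (r₁ r₂ : ℕ) → 1 ≤ r₁ → 1 ≤ r₂ →
    ∃[ G ] (StronglyConnected G × OutRadius G r₁ × InRadius G r₂)
proposition4 (suc p) (suc q) _ _ with ≤-total p q
... | inj₁ p≤q = _ , hub⇒radii (TwoArmDigraph.certificate p q p≤q)
... | inj₂ q≤p = _ , hub⇒radii (transpose-certificate (TwoArmDigraph.certificate q p q≤p))
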